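{- For every $n\ge 2$, the complete graph $K_n$ satisfies $\mathrm{Ric}(K_n)=1+\frac n2$.
   Context: For a graph $G=(V,E)$ (undirected, simple, locally finite, no isolated vertices; $y\sim x$ means adjacency) and $f,g:V\to\mathbb R$ define $\Delta f(x)=\sum_{y\sim x}(f(y)-f(x))$, $\Gamma(f,g)(x)=\frac12\sum_{y\sim x}(f(x)-f(y))(g(x)-g(y))$, $\Gamma(f)=\Gamma(f,f)$, $\Gamma_2(f)=\frac12\Delta\Gamma(f)-\Gamma(f,\Delta f)$. The curvature $\mathrm{Ric}(G)$ is the largest $K\in\mathbb R$ such that $\Gamma_2(f)(x)\ge K\,\Gamma(f)(x)$ for all $f:V\to\mathbb R$ and all $x\in V$.
   Formalization: The test functions f and the constants K in the definition of Ric take values in ℚ rather than ℝ. -}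

module Defs where

open import Data.Nat using (ℕ; zero; suc)
open import Data.Fin using (Fin; zero; suc; _≟_)
open import Data.Bool using (Bool; true; false; if_then_else_; not)
open import Data.Integer using (+_)
open import Data.Rational using (ℚ; 0ℚ; 1ℚ; ½; _+_; _*_; _-_; _≤_; _/_)
open import Relation.Nullary.Decidable using (⌊_⌋)
open import Relation.Binary.PropositionalEquality using (_≡_; refl; sym)
open import Relation.Nullary using (yes; no)
open import Data.Empty using (⊥-elim)
open import Data.Product using (_×_)

record Graph (n : ℕ) : Set where
  field
    adj   : Fin n → Fin n → Bool
    adj-sym : ∀ x y → adj x y ≡ adj y x
    adj-irr : ∀ x → adj x x ≡ false
open Graph public

sumFin : (n : ℕ) → (Fin n → ℚ) → ℚ
sumFin zero    t = 0ℚ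
sumFin (suc n) t = t zero + sumFin n (λ i → t (suc i))

nbSum : ∀ {n} → Graph n → Fin n → (Fin n → ℚ) → ℚ
nbSum {n} G x t = sumFin n (λ y → if adj G x y then t y else 0ℚ)

Δ : ∀ {n} → Graph n → (Fin n → ℚ) → Fin n → ℚ
Δ G f x = nbSum G x (λ y → f y - f x)

Γ⟨_⟩ : ∀ {n} → Graph n → (Fin n → ℚ) → (Fin n → ℚ) → Fin n → ℚ
Γ⟨ G ⟩ f g x = ½ * nbSum G x (λ y → (f x - f y) * (g x - g y))

Γ : ∀ {n} → Graph n → (Fin n → ℚ) → Fin n → ℚ
Γ G f = Γ⟨ G ⟩ f f

Γ₂ : ∀ {n} → Graph n → (Fin n → ℚ) → Fin n → ℚ
Γ₂ G f x = ½ * Δ G (Γ G f) x - Γ⟨ G ⟩ f (Δ G f) x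

CD : ∀ {n} → Graph n → ℚ → Set
CD G K = ∀ f x → K * Γ G f x ≤ Γ₂ G f x

RicIs : ∀ {n} → Graph n → ℚ → Set
RicIs G K = CD G K × (∀ K′ → CD G K′ → K′ ≤ K)

complete : (n : ℕ) → Graph n
complete n = record { adj = λ x y → not ⌊ x ≟ y ⌋ ; adj-sym = s ; adj-irr = i }
  where
  s : ∀ x y → not ⌊ x ≟ y ⌋ ≡ not ⌊ y ≟ x ⌋
  s x y with x ≟ y | y ≟ x
  ... | yes _ | yes _ = refl
  ... | no _  | no _  = refl
  ... | yes p | no q  = ⊥-elim (q (sym p))
  ... | no p  | yes q = ⊥-elim (p (sym q))
  i : ∀ x → not ⌊ x ≟ x ⌋ ≡ false
  i x with x ≟ x
  ... | yes _ = refl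
  ... | no p  = ⊥-elim (p refl)

ℕ→ℚ : ℕ → ℚ
ℕ→ℚ n = + n / 1

{-# OPTIONS --safe #-}
module Submission where

-- On K_n every vertex is adjacent to all others, so with g = f − f x and the neighbour sums
-- S = Σ_{y∼x} g y, Q = Σ_{y∼x} (g y)², all the operators become quadratic polynomials in g:
-- Δf y = S − n g y and Γf y = ½ (n (g y)² − 2 g y S + Q). Summing once more gives
--   Γ₂(f)(x) = (1 + n/2) Γ(f)(x) + ½ ((n − 1) Q − S²),
-- where the defect is nonnegative by Cauchy–Schwarz over the n − 1 neighbours of x. For the
-- indicator of V ∖ {x} the defect vanishes while Γ(f)(x) = (n − 1)/2 > 0, so 1 + n/2 is optimal.

open import Defs
open import Data.Nat using (ℕ; _≤_)
open import Data.Rational using (1ℚ; ½; _+_; _*_)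

open import Level using (0ℓ)
open import Data.Nat using (zero; suc; s≤s; z≤n; NonZero)
open import Data.Fin using (Fin; zero; suc; punchIn; _≟_)
open import Data.Fin.Properties using (punchInᵢ≢i)
open import Data.Bool using (true; not; if_then_else_)
open import Data.Product using (_,_)
open import Data.Sum using (inj₁; inj₂)
open import Data.Vec.Functional using (removeAt)
open import Function using (_∘_)
import Data.Integer as ℤ
import Data.Integer.Tactic.RingSolver as ℤ-Solver
open import Data.Rational using (ℚ; 0ℚ; _-_; -_; toℚᵘ; Positive; nonNegative; nonPositive)
import Data.Rational as ℚ
open import Data.Rational.Properties
  using (+-*-commutativeRing; toℚᵘ-injective; toℚᵘ-fromℚᵘ; toℚᵘ-homo-+; normalize-pos;
         +-identityˡ; +-identityʳ; +-inverseʳ; *-zeroˡ; *-identityʳ;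
         ≤-refl; ≤-total; +-mono-≤; +-monoʳ-≤; *-monoˡ-≤-nonNeg; *-cancelʳ-≤-pos; module ≤-Reasoning;
         nonNegative⁻¹; nonNeg*nonNeg⇒nonNeg; nonPos*nonPos⇒nonPos; pos*pos⇒pos)
import Data.Rational.Unnormalised as ℚᵘ
import Data.Rational.Unnormalised.Properties as ℚᵘ
open import Algebra.Bundles using (CommutativeRing)
open import Algebra.Properties.Semiring.Sum (CommutativeRing.semiring +-*-commutativeRing)
  using (sum; sum-syntax; sum-cong-≗; sum-remove; ∑-distrib-+; *-distribˡ-sum)
open import Relation.Nullary.Decidable using (dec⇒maybe; isYes≗does; dec-false)
open import Relation.Binary.PropositionalEquality
open import Tactic.RingSolver using (solve-∀)
open import Tactic.RingSolver.Core.AlmostCommutativeRing using (AlmostCommutativeRing; fromCommutativeRing)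

ℚ-ring : AlmostCommutativeRing 0ℓ 0ℓ
ℚ-ring = fromCommutativeRing +-*-commutativeRing (λ p → dec⇒maybe (0ℚ ℚ.≟ p))

ℕ→ℚ-suc : ∀ m → ℕ→ℚ (suc m) ≡ 1ℚ + ℕ→ℚ m
ℕ→ℚ-suc m = toℚᵘ-injective (begin
  toℚᵘ (ℕ→ℚ (suc m))             ≈⟨ toℚᵘ-fromℚᵘ (ℚᵘ.mkℚᵘ (ℤ.+ suc m) 0) ⟩
  ℚᵘ.mkℚᵘ (ℤ.+ suc m) 0          ≈⟨ ℚᵘ.*≡* (ℤ-identity (ℤ.+ m)) ⟩
  ℚᵘ.1ℚᵘ ℚᵘ.+ ℚᵘ.mkℚᵘ (ℤ.+ m) 0  ≈⟨ ℚᵘ.+-congʳ ℚᵘ.1ℚᵘ (ℚᵘ.≃-sym (toℚᵘ-fromℚᵘ (ℚᵘ.mkℚᵘ (ℤ.+ m) 0))) ⟩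
  toℚᵘ 1ℚ ℚᵘ.+ toℚᵘ (ℕ→ℚ m)      ≈⟨ ℚᵘ.≃-sym (toℚᵘ-homo-+ 1ℚ (ℕ→ℚ m)) ⟩
  toℚᵘ (1ℚ + ℕ→ℚ m)              ∎)
  where
  open ℚᵘ.≃-Reasoning
  ℤ-identity : ∀ k → (ℤ.+ 1 ℤ.+ k) ℤ.* ℤ.+ 1 ≡ (ℤ.+ 1 ℤ.* ℤ.+ 1 ℤ.+ k ℤ.* ℤ.+ 1) ℤ.* ℤ.+ 1
  ℤ-identity = ℤ-Solver.solve-∀

[p-p]*q≡0 : ∀ p q → (p - p) * q ≡ 0ℚ
[p-p]*q≡0 p q = trans (cong (_* q) (+-inverseʳ p)) (*-zeroˡ q)

0≤p*p : ∀ p → 0ℚ ℚ.≤ p * p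
0≤p*p p with ≤-total 0ℚ p
... | inj₁ 0≤p = nonNegative⁻¹ (p * p) {{nonNeg*nonNeg⇒nonNeg p {{nonNegative 0≤p}} p {{nonNegative 0≤p}}}}
... | inj₂ p≤0 = nonNegative⁻¹ (p * p) {{nonPos*nonPos⇒nonPos p {{nonPositive p≤0}} p {{nonPositive p≤0}}}}

0≤½*p : ∀ {p} → 0ℚ ℚ.≤ p → 0ℚ ℚ.≤ ½ * p
0≤½*p = *-monoˡ-≤-nonNeg ½

p≤p+q : ∀ p {q} → 0ℚ ℚ.≤ q → p ℚ.≤ p + q
p≤p+q p {q} 0≤q = subst (ℚ._≤ p + q) (+-identityʳ p) (+-monoʳ-≤ p 0≤q)

sumFin≡sum : ∀ n (t : Fin n → ℚ) → sumFin n t ≡ sum t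
sumFin≡sum zero    t = refl
sumFin≡sum (suc n) t = cong (t zero +_) (sumFin≡sum n (λ i → t (suc i)))

sum-const : ∀ n c → sum {n} (λ _ → c) ≡ ℕ→ℚ n * c
sum-const zero    c = sym (*-zeroˡ c)
sum-const (suc n) c = begin
  c + sum {n} (λ _ → c)  ≡⟨ cong (c +_) (sum-const n c) ⟩
  c + ℕ→ℚ n * c          ≡⟨ expand c (ℕ→ℚ n) ⟩
  (1ℚ + ℕ→ℚ n) * c       ≡⟨ cong (_* c) (sym (ℕ→ℚ-suc n)) ⟩
  ℕ→ℚ (suc n) * c        ∎
  where
  open ≡-Reasoning
  expand : ∀ c N → c + N * c ≡ (1ℚ + N) * c
  expand = solve-∀ ℚ-ring

sum-quadratic : ∀ n (g h : Fin n → ℚ) α β γ →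
                (∀ z → h z ≡ α + β * g z + γ * (g z * g z)) →
                sum h ≡ ℕ→ℚ n * α + β * sum g + γ * sum (λ z → g z * g z)
sum-quadratic n g h α β γ h≗ = begin
  sum h                                               ≡⟨ sum-cong-≗ h≗ ⟩
  sum (λ z → α + β * g z + γ * g² z)                  ≡⟨ ∑-distrib-+ (λ z → α + β * g z) (λ z → γ * g² z) ⟩
  sum (λ z → α + β * g z) + sum (λ z → γ * g² z)      ≡⟨ cong (_+ sum (λ z → γ * g² z)) (∑-distrib-+ {n} (λ _ → α) (λ z → β * g z)) ⟩
  sum {n} (λ _ → α) + sum (λ z → β * g z) + sum (λ z → γ * g² z)
    ≡⟨ cong₂ _+_ (cong₂ _+_ (sum-const n α) (sym (*-distribˡ-sum β g))) (sym (*-distribˡ-sum γ g²)) ⟩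
  ℕ→ℚ n * α + β * sum g + γ * sum g²                  ∎
  where
  open ≡-Reasoning
  g² : Fin n → ℚ
  g² z = g z * g z

sum-removeAt : ∀ {m} (t : Fin (suc m) → ℚ) x → t x ≡ 0ℚ → sum t ≡ sum (removeAt t x)
sum-removeAt t x tx≡0 = begin
  sum t                       ≡⟨ sum-remove t ⟩
  t x + sum (removeAt t x)    ≡⟨ cong (_+ sum (removeAt t x)) tx≡0 ⟩
  0ℚ + sum (removeAt t x)     ≡⟨ +-identityˡ (sum (removeAt t x)) ⟩
  sum (removeAt t x)          ∎
  where open ≡-Reasoning

sum-nonneg : ∀ {n} (t : Fin n → ℚ) → (∀ i → 0ℚ ℚ.≤ t i) → 0ℚ ℚ.≤ sum t
sum-nonneg {zero}  t 0≤t = ≤-refl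
sum-nonneg {suc n} t 0≤t = +-mono-≤ (0≤t zero) (sum-nonneg (λ i → t (suc i)) (λ i → 0≤t (suc i)))

lagrange-identity : ∀ n (v : Fin n → ℚ) →
  ∑[ i < n ] ∑[ j < n ] ((v i - v j) * (v i - v j)) ≡
  (ℕ→ℚ n * sum (λ i → v i * v i) - sum v * sum v) + (ℕ→ℚ n * sum (λ i → v i * v i) - sum v * sum v)
lagrange-identity n v = begin
  sum (λ i → sum (λ j → (v i - v j) * (v i - v j))) ≡⟨ sum-quadratic n v _ Q (- (S + S)) N inner-sum ⟩
  N * Q + (- (S + S)) * S + N * Q                   ≡⟨ collect N Q S ⟩
  (N * Q - S * S) + (N * Q - S * S)                 ∎
  where
  open ≡-Reasoning
  N S Q : ℚ
  N = ℕ→ℚ n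
  S = sum v
  Q = sum (λ i → v i * v i)
  square-diff : ∀ a b → (a - b) * (a - b) ≡ a * a + (- (a + a)) * b + 1ℚ * (b * b)
  square-diff = solve-∀ ℚ-ring
  reorder : ∀ a N S Q → N * (a * a) + (- (a + a)) * S + 1ℚ * Q ≡ Q + (- (S + S)) * a + N * (a * a)
  reorder = solve-∀ ℚ-ring
  collect : ∀ N Q S → N * Q + (- (S + S)) * S + N * Q ≡ (N * Q - S * S) + (N * Q - S * S)
  collect = solve-∀ ℚ-ring
  inner-sum : ∀ i → sum (λ j → (v i - v j) * (v i - v j)) ≡ Q + (- (S + S)) * v i + N * (v i * v i)
  inner-sum i = trans (sum-quadratic n v _ (v i * v i) (- (v i + v i)) 1ℚ (λ j → square-diff (v i) (v j)))
                      (reorder (v i) N S Q)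

cauchy-schwarz : ∀ n (v : Fin n → ℚ) → 0ℚ ℚ.≤ ℕ→ℚ n * sum (λ i → v i * v i) - sum v * sum v
cauchy-schwarz n v = begin
  0ℚ                                                      ≤⟨ 0≤½*p (sum-nonneg _ (λ i → sum-nonneg _ (λ j → 0≤p*p (v i - v j)))) ⟩
  ½ * ∑[ i < n ] ∑[ j < n ] ((v i - v j) * (v i - v j))   ≡⟨ cong (½ *_) (lagrange-identity n v) ⟩
  ½ * (D + D)                                             ≡⟨ halve D ⟩
  D                                                       ∎
  where
  open ≤-Reasoning
  D : ℚ
  D = ℕ→ℚ n * sum (λ i → v i * v i) - sum v * sum v
  halve : ∀ D → ½ * (D + D) ≡ D
  halve = solve-∀ ℚ-ring

adj-complete : ∀ {n} {x y : Fin n} → x ≢ y → adj (complete n) x y ≡ true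
adj-complete {x = x} {y} x≢y = cong not (trans (isYes≗does (x ≟ y)) (dec-false (x ≟ y) x≢y))

nbSum-complete : ∀ {m} x (t : Fin (suc m) → ℚ) → nbSum (complete (suc m)) x t ≡ sum (removeAt t x)
nbSum-complete {m} x t = begin
  nbSum G x t                 ≡⟨ sumFin≡sum (suc m) t∼ ⟩
  sum t∼                      ≡⟨ sum-removeAt t∼ x (cong (if_then t x else 0ℚ) (adj-irr G x)) ⟩
  sum (removeAt t∼ x)         ≡⟨ sum-cong-≗ (λ i → cong (if_then t (punchIn x i) else 0ℚ) (adj-complete (punchInᵢ≢i x i ∘ sym))) ⟩
  sum (removeAt t x)          ∎
  where
  open ≡-Reasoning
  G : Graph (suc m)
  G = complete (suc m)
  t∼ : Fin (suc m) → ℚ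
  t∼ y = if adj G x y then t y else 0ℚ

nbSum-complete-vanishing : ∀ {m} x (t : Fin (suc m) → ℚ) → t x ≡ 0ℚ → nbSum (complete (suc m)) x t ≡ sum t
nbSum-complete-vanishing x t tx≡0 = trans (nbSum-complete x t) (sym (sum-removeAt t x tx≡0))

module CompleteGraph (m : ℕ) (f : Fin (suc m) → ℚ) (x : Fin (suc m)) where
  open ≡-Reasoning

  G : Graph (suc m)
  G = complete (suc m)

  N M : ℚ
  N = ℕ→ℚ (suc m)
  M = ℕ→ℚ m

  g : Fin (suc m) → ℚ
  g z = f z - f x

  S Q D K : ℚ
  S = sum (removeAt g x)
  Q = sum (removeAt (λ z → g z * g z) x)
  D = M * Q - S * S
  K = 1ℚ + ½ * N

  sum-quadratic-g : ∀ (h : Fin (suc m) → ℚ) α β γ →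
                    (∀ z → h z ≡ α + β * g z + γ * (g z * g z)) → sum h ≡ N * α + β * S + γ * Q
  sum-quadratic-g h α β γ h≗ = begin
    sum h                                          ≡⟨ sum-quadratic (suc m) g h α β γ h≗ ⟩
    N * α + β * sum g + γ * sum (λ z → g z * g z)  ≡⟨ cong₂ (λ s q → N * α + β * s + γ * q) sum-g sum-g² ⟩
    N * α + β * S + γ * Q                          ∎
    where
    gx≡0 : g x ≡ 0ℚ
    gx≡0 = +-inverseʳ (f x)
    sum-g : sum g ≡ S
    sum-g = sum-removeAt g x gx≡0
    sum-g² : sum (λ z → g z * g z) ≡ Q
    sum-g² = sum-removeAt (λ z → g z * g z) x ([p-p]*q≡0 (f x) (g x))

  Δ-complete : ∀ y → Δ G f y ≡ S - N * g y
  Δ-complete y = begin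
    Δ G f y                        ≡⟨ nbSum-complete-vanishing y (λ z → f z - f y) (+-inverseʳ (f y)) ⟩
    sum (λ z → f z - f y)          ≡⟨ sum-quadratic-g _ (- g y) 1ℚ 0ℚ (λ z → expand (f x) (f y) (f z)) ⟩
    N * (- g y) + 1ℚ * S + 0ℚ * Q  ≡⟨ collect N (g y) S Q ⟩
    S - N * g y                    ∎
    where
    expand : ∀ a b c → c - b ≡ - (b - a) + 1ℚ * (c - a) + 0ℚ * ((c - a) * (c - a))
    expand = solve-∀ ℚ-ring
    collect : ∀ N b S Q → N * (- b) + 1ℚ * S + 0ℚ * Q ≡ S - N * b
    collect = solve-∀ ℚ-ring

  Γ-complete : ∀ y → Γ G f y ≡ ½ * (N * (g y * g y) - (g y + g y) * S + Q)
  Γ-complete y = begin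
    Γ G f y
      ≡⟨ cong (½ *_) (nbSum-complete-vanishing y (λ z → (f y - f z) * (f y - f z)) ([p-p]*q≡0 (f y) (f y - f y))) ⟩
    ½ * sum (λ z → (f y - f z) * (f y - f z))
      ≡⟨ cong (½ *_) (sum-quadratic-g _ (g y * g y) (- (g y + g y)) 1ℚ (λ z → expand (f x) (f y) (f z))) ⟩
    ½ * (N * (g y * g y) + (- (g y + g y)) * S + 1ℚ * Q)
      ≡⟨ cong (½ *_) (collect N (g y) S Q) ⟩
    ½ * (N * (g y * g y) - (g y + g y) * S + Q) ∎
    where
    expand : ∀ a b c → (b - c) * (b - c) ≡ (b - a) * (b - a) + (- ((b - a) + (b - a))) * (c - a) + 1ℚ * ((c - a) * (c - a))
    expand = solve-∀ ℚ-ring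
    collect : ∀ N b S Q → N * (b * b) + (- (b + b)) * S + 1ℚ * Q ≡ N * (b * b) - (b + b) * S + Q
    collect = solve-∀ ℚ-ring

  Γ-centre : Γ G f x ≡ ½ * Q
  Γ-centre = trans (Γ-complete x) (vanish (f x) N S Q)
    where
    vanish : ∀ a N S Q → ½ * (N * ((a - a) * (a - a)) - ((a - a) + (a - a)) * S + Q) ≡ ½ * Q
    vanish = solve-∀ ℚ-ring

  ΔΓ-complete : Δ G (Γ G f) x ≡ ½ * (N * Q) - S * S
  ΔΓ-complete = begin
    Δ G (Γ G f) x                         ≡⟨ nbSum-complete-vanishing x (λ y → Γ G f y - Γ G f x) (+-inverseʳ (Γ G f x)) ⟩
    sum (λ y → Γ G f y - Γ G f x)         ≡⟨ sum-quadratic-g _ 0ℚ (- S) (½ * N) increment ⟩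
    N * 0ℚ + (- S) * S + (½ * N) * Q      ≡⟨ collect N S Q ⟩
    ½ * (N * Q) - S * S                   ∎
    where
    expand : ∀ b N S Q → ½ * (N * (b * b) - (b + b) * S + Q) - ½ * Q ≡ 0ℚ + (- S) * b + (½ * N) * (b * b)
    expand = solve-∀ ℚ-ring
    increment : ∀ y → Γ G f y - Γ G f x ≡ 0ℚ + (- S) * g y + (½ * N) * (g y * g y)
    increment y = trans (cong₂ _-_ (Γ-complete y) Γ-centre) (expand (g y) N S Q)
    collect : ∀ N S Q → N * 0ℚ + (- S) * S + (½ * N) * Q ≡ ½ * (N * Q) - S * S
    collect = solve-∀ ℚ-ring

  ΓΔ-complete : Γ⟨ G ⟩ f (Δ G f) x ≡ - (½ * (N * Q))
  ΓΔ-complete = begin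
    Γ⟨ G ⟩ f (Δ G f) x
      ≡⟨ cong (½ *_) (nbSum-complete-vanishing x (λ y → (f x - f y) * (Δ G f x - Δ G f y)) ([p-p]*q≡0 (f x) _)) ⟩
    ½ * sum (λ y → (f x - f y) * (Δ G f x - Δ G f y))
      ≡⟨ cong (½ *_) (sum-quadratic-g _ 0ℚ 0ℚ (- N) product) ⟩
    ½ * (N * 0ℚ + 0ℚ * S + (- N) * Q)
      ≡⟨ collect N S Q ⟩
    - (½ * (N * Q)) ∎
    where
    expand : ∀ a b N S → (a - b) * ((S - N * (a - a)) - (S - N * (b - a))) ≡ 0ℚ + 0ℚ * (b - a) + (- N) * ((b - a) * (b - a))
    expand = solve-∀ ℚ-ring
    product : ∀ y → (f x - f y) * (Δ G f x - Δ G f y) ≡ 0ℚ + 0ℚ * g y + (- N) * (g y * g y)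
    product y = trans (cong (λ d → (f x - f y) * d) (cong₂ _-_ (Δ-complete x) (Δ-complete y))) (expand (f x) (f y) N S)
    collect : ∀ N S Q → ½ * (N * 0ℚ + 0ℚ * S + (- N) * Q) ≡ - (½ * (N * Q))
    collect = solve-∀ ℚ-ring

  Γ₂-complete : Γ₂ G f x ≡ K * Γ G f x + ½ * D
  Γ₂-complete = begin
    ½ * Δ G (Γ G f) x - Γ⟨ G ⟩ f (Δ G f) x           ≡⟨ cong₂ (λ a b → ½ * a - b) ΔΓ-complete ΓΔ-complete ⟩
    ½ * (½ * (N * Q) - S * S) - - (½ * (N * Q))     ≡⟨ cong (λ n → ½ * (½ * (n * Q) - S * S) - - (½ * (n * Q))) (ℕ→ℚ-suc m) ⟩
    ½ * (½ * ((1ℚ + M) * Q) - S * S) - - (½ * ((1ℚ + M) * Q))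
                                                    ≡⟨ rearrange M Q S ⟩
    (1ℚ + ½ * (1ℚ + M)) * (½ * Q) + ½ * (M * Q - S * S)
                                                    ≡⟨ cong₂ (λ n γ → (1ℚ + ½ * n) * γ + ½ * (M * Q - S * S)) (sym (ℕ→ℚ-suc m)) (sym Γ-centre) ⟩
    (1ℚ + ½ * N) * Γ G f x + ½ * (M * Q - S * S)     ∎
    where
    rearrange : ∀ M Q S → ½ * (½ * ((1ℚ + M) * Q) - S * S) - - (½ * ((1ℚ + M) * Q))
                          ≡ (1ℚ + ½ * (1ℚ + M)) * (½ * Q) + ½ * (M * Q - S * S)
    rearrange = solve-∀ ℚ-ring

CD-complete : ∀ m → CD (complete (suc m)) (1ℚ + ½ * ℕ→ℚ (suc m))
CD-complete m f x = begin
  K * Γ G f x            ≤⟨ p≤p+q (K * Γ G f x) (0≤½*p (cauchy-schwarz m (removeAt g x))) ⟩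
  K * Γ G f x + ½ * D    ≡⟨ Γ₂-complete ⟨
  Γ₂ G f x               ∎
  where
  open CompleteGraph m f x
  open ≤-Reasoning

CD-upper-bound : ∀ {n} (G : Graph n) {K K′} (f : Fin n → ℚ) x → Positive (Γ G f x) →
                 Γ₂ G f x ≡ K * Γ G f x → CD G K′ → K′ ℚ.≤ K
CD-upper-bound G {K′ = K′} f x Γ>0 Γ₂≡KΓ cd =
  *-cancelʳ-≤-pos (Γ G f x) {{Γ>0}} (subst (K′ * Γ G f x ℚ.≤_) Γ₂≡KΓ (cd f x))

indicator-suc : ∀ {m} → Fin (suc m) → ℚ
indicator-suc zero    = 0ℚ
indicator-suc (suc _) = 1ℚ

Ric-complete : ∀ m → .{{NonZero m}} → RicIs (complete (suc m)) (1ℚ + ½ * ℕ→ℚ (suc m))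
Ric-complete m = CD-complete m , λ K′ → CD-upper-bound G indicator-suc zero Γ>0 Γ₂-indicator
  where
  open CompleteGraph m indicator-suc zero
  open ≡-Reasoning

  Γ-indicator : Γ G indicator-suc zero ≡ ½ * M
  Γ-indicator = begin
    Γ G indicator-suc zero  ≡⟨ Γ-centre ⟩
    ½ * Q                   ≡⟨ cong (½ *_) (trans (sum-const m 1ℚ) (*-identityʳ M)) ⟩
    ½ * M                   ∎

  Γ>0 : Positive (Γ G indicator-suc zero)
  Γ>0 = subst Positive (sym Γ-indicator) (pos*pos⇒pos ½ M {{normalize-pos m 1}})

  no-defect : D ≡ 0ℚ
  no-defect = begin
    M * Q - S * S                          ≡⟨ cong₂ (λ q s → M * q - s * s) (sum-const m 1ℚ) (sum-const m 1ℚ) ⟩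
    M * (M * 1ℚ) - (M * 1ℚ) * (M * 1ℚ)     ≡⟨ cancel M ⟩
    0ℚ                                     ∎
    where
    cancel : ∀ M → M * (M * 1ℚ) - (M * 1ℚ) * (M * 1ℚ) ≡ 0ℚ
    cancel = solve-∀ ℚ-ring

  Γ₂-indicator : Γ₂ G indicator-suc zero ≡ K * Γ G indicator-suc zero
  Γ₂-indicator = begin
    Γ₂ G indicator-suc zero                   ≡⟨ Γ₂-complete ⟩
    K * Γ G indicator-suc zero + ½ * D        ≡⟨ cong (λ d → K * Γ G indicator-suc zero + ½ * d) no-defect ⟩
    K * Γ G indicator-suc zero + ½ * 0ℚ       ≡⟨ +-identityʳ (K * Γ G indicator-suc zero) ⟩
    K * Γ G indicator-suc zero                ∎

theorem4 : (n : ℕ) → 2 ≤ n → RicIs (complete n) (1ℚ + ½ * ℕ→ℚ n)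
theorem4 (suc (suc k)) (s≤s (s≤s z≤n)) = Ric-complete (suc k)
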